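{- Let $k\in\mathbb{N}$ and let $(\mathbf{A},\mathbf{B})$ be a PCSP template of finite $\sigma$-structures. Then the minions $\mathrm{Pol}(\mathbf{A},\mathbf{B})$ and $\mathrm{Pol}(\mathbf{A}^{\otimes k},\mathbf{B}^{\otimes k})$ are homomorphically equivalent. If, in addition, $\mathbf{A}$ is $k$-enhanced, then $\mathrm{Pol}(\mathbf{A},\mathbf{B})$ and $\mathrm{Pol}(\mathbf{A}^{\otimes k},\mathbf{B}^{\otimes k})$ are isomorphic.
   Context: A $\sigma$-structure $\mathbf{A}$ has domain $A$ and relations $R^{\mathbf{A}}\subseteq A^{\mathrm{ar}(R)}$; homomorphisms preserve all relations coordinatewise. A PCSP template is a pair $(\mathbf{A},\mathbf{B})$ of $\sigma$-structures with a homomorphism $\mathbf{A}\to\mathbf{B}$. A $\sigma$-structure is $k$-enhanced if $\sigma$ contains a $k$-ary symbol $R_k$ with $R_k^{\mathbf{A}}=A^k$. For $\mathbf{a}=(a_1,\dots,a_r)$ and $\mathbf{i}=(i_1,\dots,i_k)\in[r]^k$, $\mathbf{a}_{\mathbf{i}}=(a_{i_1},\dots,a_{i_k})$. Tensor power: $\mathbf{A}^{\otimes k}$ has the same symbols, where $R$ of arity $r$ gets arity $r^k$ with positions indexed by $[r]^k$; domain $A^k$; $R^{\mathbf{A}^{\otimes k}}=\{\mathbf{a}^{\otimes k}:\mathbf{a}\in R^{\mathbf{A}}\}$ with $\mathbf{a}^{\otimes k}$ the family whose $\mathbf{i}$-th entry is $\mathbf{a}_{\mathbf{i}}$. The $L$-th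 power $\mathbf{A}^L$ has domain $A^L$, and a tuple $(t_1,\dots,t_r)$ with $t_j\in A^L$ (indexed by the positions of $R$) is in $R^{\mathbf{A}^L}$ iff for each $\ell\in[L]$ the tuple of $\ell$-th coordinates $(t_1(\ell),\dots,t_r(\ell))$ is in $R^{\mathbf{A}}$. An $L$-ary polymorphism of $(\mathbf{A},\mathbf{B})$ is a homomorphism $\mathbf{A}^L\to\mathbf{B}$. A minion is a disjoint union of sets $\mathscr{M}^{(L)}$, $L\in\mathbb{N}$, with minor maps $(\cdot)_{/\pi}:\mathscr{M}^{(L)}\to\mathscr{M}^{(L')}$ for each $\pi:[L]\to[L']$ such that $M_{/\mathrm{id}}=M$ and $(M_{/\pi})_{/\tilde\pi}=M_{/\tilde\pi\circ\pi}$. $\mathrm{Pol}(\mathbf{A},\mathbf{B})$ is the minion of all polymorphisms with $f_{/\pi}(a_1,\dots,a_{L'})=f(a_{\pi(1)},\dots,a_{\pi(L)})$. A minion homomorphism $\mathscr{M}\to\mathscr{N}$ maps $\mathscr{M}^{(L)}$ into $\mathscr{N}^{(L)}$ and commutes with all minor maps; two minions are homomorphically equivalent if there are minion homomorphisms in both directions, and isomorphic if there is a bijective minion homomorphism whose inverse is a minion homomorphism. -}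

module Defs where

open import Level using (0ℓ) renaming (suc to lsuc)
open import Data.Nat using (ℕ; zero; suc; _^_)
open import Data.Fin using (Fin; remQuot)
open import Data.Vec using (Vec; []; _∷_; lookup; tabulate; map)
open import Data.Product using (Σ; _×_; _,_; proj₁; proj₂)
open import Function using (_∘_; id)
open import Function.Bundles using (_↔_)
open import Relation.Binary.Bundles using (Setoid)
open import Relation.Binary.PropositionalEquality using (_≡_; refl; sym; trans; cong)

record Sig : Set where
  field
    nsym : ℕ
    ar   : Fin nsym → ℕ
open Sig public

record Structure (σ : Sig) : Set₁ where
  field
    Carrier : Set
    rel     : (R : Fin (nsym σ)) → Vec Carrier (ar σ R) → Set
open Structure public

Finite : ∀ {σ} → Structure σ → Set
Finite 𝐀 = Σ ℕ λ n → Fin n ↔ Carrier 𝐀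

IsHom : ∀ {σ} (𝐀 𝐁 : Structure σ) → (Carrier 𝐀 → Carrier 𝐁) → Set
IsHom {σ} 𝐀 𝐁 h = ∀ (R : Fin (nsym σ)) (a : Vec (Carrier 𝐀) (ar σ R)) →
  rel 𝐀 R a → rel 𝐁 R (map h a)

Hom : ∀ {σ} (𝐀 𝐁 : Structure σ) → Set
Hom 𝐀 𝐁 = Σ (Carrier 𝐀 → Carrier 𝐁) (IsHom 𝐀 𝐁)

Enhanced : ∀ {σ} (k : ℕ) → Structure σ → Set
Enhanced {σ} k 𝐀 = Σ (Fin (nsym σ)) λ R → (ar σ R ≡ k) ×
  (∀ (a : Vec (Carrier 𝐀) (ar σ R)) → rel 𝐀 R a)

-- The standard bijection Fin (r ^ k) ≅ [r]^k (built from remQuot),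
-- used to index the r^k positions of a tensor relation by [r]^k.
decode : ∀ {r} k → Fin (r ^ k) → Vec (Fin r) k
decode zero    p = []
decode {r} (suc k) p = proj₁ (remQuot {r} (r ^ k) p) ∷ decode k (proj₂ (remQuot {r} (r ^ k) p))

tensorSig : ℕ → Sig → Sig
tensorSig k σ = record { nsym = nsym σ ; ar = λ R → ar σ R ^ k }

tensorTuple : ∀ {A : Set} {r} k → Vec A r → Vec (Vec A k) (r ^ k)
tensorTuple k a = tabulate λ p → map (lookup a) (decode k p)

_⊗^_ : ∀ {σ} → Structure σ → (k : ℕ) → Structure (tensorSig k σ)
_⊗^_ {σ} 𝐀 k = record
  { Carrier = Vec (Carrier 𝐀) k
  ; rel = λ R t → Σ (Vec (Carrier 𝐀) (ar σ R)) λ a →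
            rel 𝐀 R a × (t ≡ tensorTuple k a)
  }

-- Minions (setoid-based; arities L ∈ ℕ = {1,2,...}, so the component
-- at index n is the arity-(suc n) part 𝓜^(1+n), and [L] = Fin (suc n)).

record Minion : Set₁ where
  field
    M      : ℕ → Setoid 0ℓ 0ℓ
  Elt : ℕ → Set
  Elt n = Setoid.Carrier (M n)
  _≈_ : ∀ {n} → Elt n → Elt n → Set
  _≈_ {n} = Setoid._≈_ (M n)
  field
    minor      : ∀ {n n'} → (Fin (suc n) → Fin (suc n')) → Elt n → Elt n'
    minor-cong : ∀ {n n'} (π : Fin (suc n) → Fin (suc n')) {x y : Elt n} →
                 x ≈ y → minor π x ≈ minor π y
    minor-id   : ∀ {n} (x : Elt n) → minor id x ≈ x
    minor-∘    : ∀ {n n' n''} (π : Fin (suc n) → Fin (suc n'))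
                 (π̃ : Fin (suc n') → Fin (suc n'')) (x : Elt n) →
                 minor π̃ (minor π x) ≈ minor (π̃ ∘ π) x

record MinionHom (𝓜 𝓝 : Minion) : Set where
  private
    module M = Minion 𝓜
    module N = Minion 𝓝
  field
    ξ      : ∀ {n} → M.Elt n → N.Elt n
    ξ-cong : ∀ {n} {x y : M.Elt n} → x M.≈ y → ξ x N.≈ ξ y
    ξ-minor : ∀ {n n'} (π : Fin (suc n) → Fin (suc n')) (x : M.Elt n) →
              ξ (M.minor π x) N.≈ N.minor π (ξ x)
open MinionHom public

HomEquivalent : Minion → Minion → Set
HomEquivalent 𝓜 𝓝 = MinionHom 𝓜 𝓝 × MinionHom 𝓝 𝓜

record MinionIso (𝓜 𝓝 : Minion) : Set where
  private
    module M = Minion 𝓜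
    module N = Minion 𝓝
  field
    to      : MinionHom 𝓜 𝓝
    from    : MinionHom 𝓝 𝓜
    from∘to : ∀ {n} (x : M.Elt n) → ξ from (ξ to x) M.≈ x
    to∘from : ∀ {n} (y : N.Elt n) → ξ to (ξ from y) N.≈ y

_^^_ : ∀ {σ} → Structure σ → ℕ → Structure σ
_^^_ {σ} 𝐀 L = record
  { Carrier = Vec (Carrier 𝐀) L
  ; rel = λ R ts → ∀ (ℓ : Fin L) → rel 𝐀 R (map (λ t → lookup t ℓ) ts)
  }

Polym : ∀ {σ} (𝐀 𝐁 : Structure σ) → ℕ → Set
Polym 𝐀 𝐁 L = Hom (𝐀 ^^ L) 𝐁

minorFun : ∀ {A B : Set} {L L'} → (Fin L → Fin L') → (Vec A L → B) → Vec A L' → B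
minorFun π f v = f (tabulate (λ i → lookup v (π i)))

private
  open import Data.Vec.Properties using (lookup∘tabulate; tabulate-cong)

  minorIsHom : ∀ {σ} (𝐀 𝐁 : Structure σ) {L L'} (π : Fin L → Fin L') (f : Polym 𝐀 𝐁 L) →
               IsHom (𝐀 ^^ L') 𝐁 (minorFun π (proj₁ f))
  minorIsHom {σ} 𝐀 𝐁 {L} {L'} π (f , hf) R ts h =
    Relation.Binary.PropositionalEquality.subst (rel 𝐁 R) eq
      (hf R (map (λ v → tabulate (λ i → lookup v (π i))) ts) λ ℓ →
        Relation.Binary.PropositionalEquality.subst (rel 𝐀 R) (sym (eq2 ℓ)) (h (π ℓ)))
    where
    import Relation.Binary.PropositionalEquality
    open import Data.Vec.Properties using (map-∘; map-cong)
    eq : map f (map (λ v → tabulate (λ i → lookup v (π i))) ts) ≡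
         map (minorFun π f) ts
    eq = sym (map-∘ f (λ v → tabulate (λ i → lookup v (π i))) ts)
    eq2 : ∀ ℓ → map (λ t → lookup t ℓ) (map (λ v → tabulate (λ i → lookup v (π i))) ts)
              ≡ map (λ t → lookup t (π ℓ)) ts
    eq2 ℓ = trans (sym (map-∘ (λ t → lookup t ℓ) (λ v → tabulate (λ i → lookup v (π i))) ts))
                  (map-cong (λ v → lookup∘tabulate (λ i → lookup v (π i)) ℓ) ts)

-- Pol(A,B) as a minion: two polymorphisms are equal iff they agree
-- pointwise (functional extensionality is not available in Agda).
Pol : ∀ {σ} (𝐀 𝐁 : Structure σ) → Minion
Pol {σ} 𝐀 𝐁 = record
  { M = λ n → record
      { Carrier = Polym 𝐀 𝐁 (suc n)
      ; _≈_ = λ f g → ∀ v → proj₁ f v ≡ proj₁ g v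
      ; isEquivalence = record
          { refl = λ v → refl
          ; sym = λ p v → sym (p v)
          ; trans = λ p q v → trans (p v) (q v) } }
  ; minor = λ π f → minorFun π (proj₁ f) , minorIsHom 𝐀 𝐁 π f
  ; minor-cong = λ π p v → p _
  ; minor-id = λ x v → cong (proj₁ x) (tabulate∘lookup' v)
  ; minor-∘ = λ π π̃ x v → cong (proj₁ x)
      (tabulate-cong (λ i → lookup∘tabulate (λ j → lookup v (π̃ j)) (π i)))
  }
  where
  open import Data.Vec.Properties using (tabulate∘lookup)
  tabulate∘lookup' : ∀ {A : Set} {m} (v : Vec A m) → tabulate (λ i → lookup v (id i)) ≡ v
  tabulate∘lookup' v = tabulate∘lookup v

{-# OPTIONS --safe #-}
-- Powers commute with tensor powers: the R-related tuples of (A^{⊗k})^L are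
-- exactly the tensor tuples c^{⊗k} of R-related tuples c of A^L, transposed
-- position by position.  Hence an L-ary polymorphism f of (A,B) applied in
-- each of the k coordinates is a polymorphism of the tensor template, and a
-- polymorphism g of the tensor template, restricted to the diagonal and read
-- at one coordinate, is a polymorphism of (A,B); both commute with minors and
-- the second undoes the first.  If A has a full k-ary relation, every L-tuple
-- of elements of A^k is itself an entry of some related c^{⊗k}, which forces g
-- to act coordinatewise, so the two maps are mutually inverse.
module Submission where

open import Defs
open import Data.Nat using (ℕ; NonZero; zero; suc; _^_)
open import Data.Product using (_×_; Σ; _,_; proj₁; proj₂)
open import Data.Fin using (Fin; combine; remQuot; cast) renaming (zero to fz)
open import Data.Fin.Properties using (remQuot-combine; cast-involutive)
open import Data.Vec using (Vec; []; _∷_; lookup; tabulate; map; replicate; transpose; _⊛_)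
open import Data.Vec.Properties
  using ( lookup-map; lookup∘tabulate; tabulate∘lookup; tabulate-cong; tabulate-∘
        ; lookup-replicate; map-replicate; map-∘; map-cong; lookup-⊛; transpose-replicate )
open import Function using (_∘_; _$_)
open import Relation.Binary.PropositionalEquality
open ≡-Reasoning

private
  variable
    A B : Set
    k L m n r : ℕ

lookup-ext : {xs ys : Vec A n} → (∀ i → lookup xs i ≡ lookup ys i) → xs ≡ ys
lookup-ext {xs = xs} {ys} eq = begin
  xs                   ≡⟨ tabulate∘lookup xs ⟨
  tabulate (lookup xs) ≡⟨ tabulate-cong eq ⟩
  tabulate (lookup ys) ≡⟨ tabulate∘lookup ys ⟩
  ys                   ∎

column : Fin n → Vec (Vec A n) m → Vec A m
column ℓ = map (λ xs → lookup xs ℓ)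

lookup-transpose : ∀ (xss : Vec (Vec A n) m) j → lookup (transpose xss) j ≡ column j xss
lookup-transpose []         j = lookup-replicate j []
lookup-transpose {A = A} {n = n} {m = suc m} (xs ∷ xss) j = begin
  lookup (conses ⊛ transpose xss) j          ≡⟨ lookup-⊛ j conses (transpose xss) ⟩
  lookup conses j (lookup (transpose xss) j) ≡⟨ cong₂ _$_ lookup-conses (lookup-transpose xss j) ⟩
  lookup xs j ∷ column j xss                 ∎
  where
  conses : Vec (Vec A m → Vec A (suc m)) n
  conses = replicate n _∷_ ⊛ xs
  lookup-conses : lookup conses j ≡ lookup xs j ∷_
  lookup-conses = trans (lookup-⊛ j (replicate n _∷_) xs) (cong (_$ lookup xs j) (lookup-replicate j _∷_))

transpose-involutive : ∀ (xss : Vec (Vec A n) m) → transpose (transpose xss) ≡ xss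
transpose-involutive xss = lookup-ext λ i → lookup-ext λ j → begin
  lookup (lookup (transpose (transpose xss)) i) j ≡⟨ cong (λ ys → lookup ys j) (lookup-transpose (transpose xss) i) ⟩
  lookup (column i (transpose xss)) j            ≡⟨ lookup-map j _ (transpose xss) ⟩
  lookup (lookup (transpose xss) j) i            ≡⟨ cong (λ ys → lookup ys i) (lookup-transpose xss j) ⟩
  lookup (column j xss) i                        ≡⟨ lookup-map i _ xss ⟩
  lookup (lookup xss i) j                        ∎

column-transpose : ∀ (xss : Vec (Vec A n) m) ℓ → column ℓ (transpose xss) ≡ lookup xss ℓ
column-transpose xss ℓ = begin
  column ℓ (transpose xss)             ≡⟨ lookup-transpose (transpose xss) ℓ ⟨
  lookup (transpose (transpose xss)) ℓ ≡⟨ cong (λ yss → lookup yss ℓ) (transpose-involutive xss) ⟩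
  lookup xss ℓ                         ∎

columns-ext : {xss yss : Vec (Vec A n) m} → (∀ ℓ → column ℓ xss ≡ column ℓ yss) → xss ≡ yss
columns-ext {xss = xss} {yss} eq = begin
  xss                         ≡⟨ transpose-involutive xss ⟨
  transpose (transpose xss)   ≡⟨ cong transpose (lookup-ext {xs = transpose xss} {transpose yss} λ ℓ →
                                   trans (lookup-transpose xss ℓ) (trans (eq ℓ) (sym (lookup-transpose yss ℓ)))) ⟩
  transpose (transpose yss)   ≡⟨ transpose-involutive yss ⟩
  yss                         ∎

map-select : ∀ (h : A → B) (xs : Vec A n) (π : Fin m → Fin n) →
             map h (tabulate (lookup xs ∘ π)) ≡ tabulate (lookup (map h xs) ∘ π)
map-select h xs π = begin
  map h (tabulate (lookup xs ∘ π)) ≡⟨ tabulate-∘ h (lookup xs ∘ π) ⟨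
  tabulate (h ∘ lookup xs ∘ π)     ≡⟨ tabulate-cong (λ i → lookup-map (π i) h xs) ⟨
  tabulate (lookup (map h xs) ∘ π) ∎

transpose-select : ∀ (xss : Vec (Vec A n) m) (π : Fin L → Fin m) →
                   transpose (tabulate (lookup xss ∘ π)) ≡ map (λ xs → tabulate (lookup xs ∘ π)) (transpose xss)
transpose-select xss π = lookup-ext λ j → begin
  lookup (transpose (tabulate (lookup xss ∘ π))) j    ≡⟨ lookup-transpose _ j ⟩
  column j (tabulate (lookup xss ∘ π))                ≡⟨ map-select _ xss π ⟩
  tabulate (lookup (column j xss) ∘ π)                ≡⟨ cong (λ xs → tabulate (lookup xs ∘ π)) (lookup-transpose xss j) ⟨
  tabulate (lookup (lookup (transpose xss) j) ∘ π)    ≡⟨ lookup-map j _ (transpose xss) ⟨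
  lookup (map (λ xs → tabulate (lookup xs ∘ π)) (transpose xss)) j ∎

encode : ∀ k → Vec (Fin r) k → Fin (r ^ k)
encode zero        []       = fz
encode {r} (suc k) (i ∷ is) = combine {r} {r ^ k} i (encode k is)

decode-encode : ∀ k (is : Vec (Fin r) k) → decode k (encode k is) ≡ is
decode-encode zero        []       = refl
decode-encode {r} (suc k) (i ∷ is) =
  cong₂ _∷_ (cong proj₁ split) (trans (cong (decode k ∘ proj₂) split) (decode-encode k is))
  where
  split : remQuot {r} (r ^ k) (combine i (encode k is)) ≡ (i , encode k is)
  split = remQuot-combine i (encode k is)

lookup-tensorTuple-encode : ∀ k (a : Vec A r) is → lookup (tensorTuple k a) (encode k is) ≡ map (lookup a) is
lookup-tensorTuple-encode k a is =
  trans (lookup∘tabulate _ (encode k is)) (cong (map (lookup a)) (decode-encode k is))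

tensorTuple-map : ∀ k (h : A → B) (a : Vec A r) → tensorTuple k (map h a) ≡ map (map h) (tensorTuple k a)
tensorTuple-map k h a = lookup-ext λ p → begin
  lookup (tensorTuple k (map h a)) p         ≡⟨ lookup∘tabulate _ p ⟩
  map (lookup (map h a)) (decode k p)        ≡⟨ map-cong (λ i → lookup-map i h a) (decode k p) ⟩
  map (h ∘ lookup a) (decode k p)            ≡⟨ map-∘ h (lookup a) (decode k p) ⟩
  map h (map (lookup a) (decode k p))        ≡⟨ cong (map h) (lookup∘tabulate _ p) ⟨
  map h (lookup (tensorTuple k a) p)         ≡⟨ lookup-map p (map h) (tensorTuple k a) ⟨
  lookup (map (map h) (tensorTuple k a)) p   ∎

tensorTupleᵀ : ∀ k → Vec (Vec A L) r → Vec (Vec (Vec A k) L) (r ^ k)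
tensorTupleᵀ k c = map transpose (tensorTuple k c)

column-tensorTupleᵀ : ∀ k ℓ (c : Vec (Vec A L) r) → column ℓ (tensorTupleᵀ k c) ≡ tensorTuple k (column ℓ c)
column-tensorTupleᵀ k ℓ c = begin
  column ℓ (map transpose (tensorTuple k c))               ≡⟨ map-∘ _ transpose (tensorTuple k c) ⟨
  map (λ xss → lookup (transpose xss) ℓ) (tensorTuple k c) ≡⟨ map-cong (λ xss → lookup-transpose xss ℓ) (tensorTuple k c) ⟩
  map (column ℓ) (tensorTuple k c)                         ≡⟨ tensorTuple-map k _ c ⟨
  tensorTuple k (column ℓ c)                               ∎

lookup-tensorTupleᵀ-encode : ∀ k (c : Vec (Vec A L) r) is →
                             lookup (tensorTupleᵀ k c) (encode k is) ≡ transpose (map (lookup c) is)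
lookup-tensorTupleᵀ-encode k c is =
  trans (lookup-map (encode k is) transpose (tensorTuple k c))
        (cong transpose (lookup-tensorTuple-encode k c is))

module _ {σ : Sig} (𝐀 : Structure σ) (k : ℕ) {L : ℕ} where

  tensorTupleᵀ-rel : ∀ R (c : Vec (Vec (Carrier 𝐀) L) (ar σ R)) →
                     rel (𝐀 ^^ L) R c → rel ((𝐀 ⊗^ k) ^^ L) R (tensorTupleᵀ k c)
  tensorTupleᵀ-rel R c c∈R ℓ = column ℓ c , c∈R ℓ , column-tensorTupleᵀ k ℓ c

  rel-tensorTupleᵀ : ∀ R ts → rel ((𝐀 ⊗^ k) ^^ L) R ts →
                     Σ (Vec (Vec (Carrier 𝐀) L) (ar σ R)) λ c → rel (𝐀 ^^ L) R c × ts ≡ tensorTupleᵀ k c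
  rel-tensorTupleᵀ R ts ts∈R = c , c∈R , columns-ext columns-agree
    where
    a : Fin L → Vec (Carrier 𝐀) (ar σ R)
    a ℓ = proj₁ (ts∈R ℓ)
    c : Vec (Vec (Carrier 𝐀) L) (ar σ R)
    c = transpose (tabulate a)
    column-c : ∀ ℓ → column ℓ c ≡ a ℓ
    column-c ℓ = trans (column-transpose (tabulate a) ℓ) (lookup∘tabulate a ℓ)
    c∈R : rel (𝐀 ^^ L) R c
    c∈R ℓ = subst (rel 𝐀 R) (sym (column-c ℓ)) (proj₁ (proj₂ (ts∈R ℓ)))
    columns-agree : ∀ ℓ → column ℓ ts ≡ column ℓ (tensorTupleᵀ k c)
    columns-agree ℓ = begin
      column ℓ ts                 ≡⟨ proj₂ (proj₂ (ts∈R ℓ)) ⟩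
      tensorTuple k (a ℓ)         ≡⟨ cong (tensorTuple k) (column-c ℓ) ⟨
      tensorTuple k (column ℓ c)  ≡⟨ column-tensorTupleᵀ k ℓ c ⟨
      column ℓ (tensorTupleᵀ k c) ∎

coordinatewise : (Vec A L → B) → Vec (Vec A k) L → Vec B k
coordinatewise f = map f ∘ transpose

diagonalAt : Fin k → (Vec (Vec A k) L → Vec B k) → Vec A L → B
diagonalAt {k = k} i₀ g x = lookup (g (map (replicate k) x)) i₀

coordinatewise-tensorTupleᵀ : ∀ k (f : Vec A L → B) (c : Vec (Vec A L) r) →
                              map (coordinatewise f) (tensorTupleᵀ k c) ≡ tensorTuple k (map f c)
coordinatewise-tensorTupleᵀ k f c = begin
  map (map f ∘ transpose) (map transpose (tensorTuple k c)) ≡⟨ map-∘ _ transpose (tensorTuple k c) ⟨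
  map (map f ∘ transpose ∘ transpose) (tensorTuple k c)     ≡⟨ map-cong (cong (map f) ∘ transpose-involutive) (tensorTuple k c) ⟩
  map (map f) (tensorTuple k c)                             ≡⟨ tensorTuple-map k f c ⟨
  tensorTuple k (map f c)                                   ∎

module _ {g : Vec (Vec A k) L → Vec B k} {c : Vec (Vec A L) r} {b : Vec B r}
         (g-tensor : map g (tensorTupleᵀ k c) ≡ tensorTuple k b) where

  tensorTupleᵀ-image : ∀ is → g (transpose (map (lookup c) is)) ≡ map (lookup b) is
  tensorTupleᵀ-image is = begin
    g (transpose (map (lookup c) is))         ≡⟨ cong g (lookup-tensorTupleᵀ-encode k c is) ⟨
    g (lookup (tensorTupleᵀ k c) p)           ≡⟨ lookup-map p g (tensorTupleᵀ k c) ⟨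
    lookup (map g (tensorTupleᵀ k c)) p       ≡⟨ cong (λ ys → lookup ys p) g-tensor ⟩
    lookup (tensorTuple k b) p                ≡⟨ lookup-tensorTuple-encode k b is ⟩
    map (lookup b) is                         ∎
    where
    p : Fin (r ^ k)
    p = encode k is

  diagonalAt-tensorTupleᵀ : ∀ i₀ i → diagonalAt i₀ g (lookup c i) ≡ lookup b i
  diagonalAt-tensorTupleᵀ i₀ i = begin
    lookup (g (map (replicate k) (lookup c i))) i₀             ≡⟨ cong (λ xs → lookup (g xs) i₀) (transpose-replicate (lookup c i)) ⟨
    lookup (g (transpose (replicate k (lookup c i)))) i₀       ≡⟨ cong (λ xs → lookup (g (transpose xs)) i₀) (map-replicate (lookup c) i k) ⟨
    lookup (g (transpose (map (lookup c) (replicate k i)))) i₀ ≡⟨ cong (λ xs → lookup xs i₀) (tensorTupleᵀ-image (replicate k i)) ⟩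
    lookup (map (lookup b) (replicate k i)) i₀                 ≡⟨ cong (λ xs → lookup xs i₀) (map-replicate (lookup b) i k) ⟩
    lookup (replicate k (lookup b i)) i₀                       ≡⟨ lookup-replicate i₀ (lookup b i) ⟩
    lookup b i                                                 ∎

  map-diagonalAt-tensorTupleᵀ : ∀ i₀ → map (diagonalAt i₀ g) c ≡ b
  map-diagonalAt-tensorTupleᵀ i₀ = lookup-ext λ i →
    trans (lookup-map i (diagonalAt i₀ g) c) (diagonalAt-tensorTupleᵀ i₀ i)

diagonalAt-coordinatewise : ∀ (i₀ : Fin k) (f : Vec A L → B) x → diagonalAt i₀ (coordinatewise f) x ≡ f x
diagonalAt-coordinatewise {k = k} i₀ f x = begin
  lookup (map f (transpose (map (replicate k) x))) i₀   ≡⟨ lookup-map i₀ f (transpose (map (replicate k) x)) ⟩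
  f (lookup (transpose (map (replicate k) x)) i₀)       ≡⟨ cong (λ xss → f (lookup (transpose xss) i₀)) (transpose-replicate x) ⟨
  f (lookup (transpose (transpose (replicate k x))) i₀) ≡⟨ cong (λ xss → f (lookup xss i₀)) (transpose-involutive (replicate k x)) ⟩
  f (lookup (replicate k x) i₀)                         ≡⟨ cong f (lookup-replicate i₀ x) ⟩
  f x                                                   ∎

module _ {σ : Sig} (𝐀 𝐁 : Structure σ) (k : ℕ) where

  coordinatewise-isHom : (f : Polym 𝐀 𝐁 L) → IsHom ((𝐀 ⊗^ k) ^^ L) (𝐁 ⊗^ k) (coordinatewise (proj₁ f))
  coordinatewise-isHom (f , f-hom) R ts ts∈R with rel-tensorTupleᵀ 𝐀 k R ts ts∈R
  ... | c , c∈R , refl = map f c , f-hom R c c∈R , coordinatewise-tensorTupleᵀ k f c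

  diagonalAt-isHom : ∀ i₀ (g : Polym (𝐀 ⊗^ k) (𝐁 ⊗^ k) L) → IsHom (𝐀 ^^ L) 𝐁 (diagonalAt i₀ (proj₁ g))
  diagonalAt-isHom i₀ (g , g-hom) R c c∈R with g-hom R (tensorTupleᵀ k c) (tensorTupleᵀ-rel 𝐀 k R c c∈R)
  ... | b , b∈R , g-tensor = subst (rel 𝐁 R) (sym (map-diagonalAt-tensorTupleᵀ {c = c} {b} g-tensor i₀)) b∈R

  coordinatewiseHom : MinionHom (Pol 𝐀 𝐁) (Pol (𝐀 ⊗^ k) (𝐁 ⊗^ k))
  coordinatewiseHom = record
    { ξ       = λ f → coordinatewise (proj₁ f) , coordinatewise-isHom f
    ; ξ-cong  = λ f≈g v → map-cong f≈g (transpose v)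
    ; ξ-minor = λ π f v → begin
        map (λ u → proj₁ f (tabulate (lookup u ∘ π))) (transpose v)      ≡⟨ map-∘ (proj₁ f) _ (transpose v) ⟩
        map (proj₁ f) (map (λ u → tabulate (lookup u ∘ π)) (transpose v)) ≡⟨ cong (map (proj₁ f)) (transpose-select v π) ⟨
        map (proj₁ f) (transpose (tabulate (lookup v ∘ π)))              ∎
    }

  diagonalHom : Fin k → MinionHom (Pol (𝐀 ⊗^ k) (𝐁 ⊗^ k)) (Pol 𝐀 𝐁)
  diagonalHom i₀ = record
    { ξ       = λ g → diagonalAt i₀ (proj₁ g) , diagonalAt-isHom i₀ g
    ; ξ-cong  = λ g≈h x → cong (λ ys → lookup ys i₀) (g≈h (map (replicate k) x))
    ; ξ-minor = λ π g x → cong (λ xss → lookup (proj₁ g xss) i₀) (sym (map-select (replicate k) x π))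
    }

  coordinatewise-diagonalAt : ∀ (i₀ : Fin k) R → (∀ a → rel 𝐀 R a) →
    (ι : Fin k → Fin (ar σ R)) (ρ : Fin (ar σ R) → Fin k) → (∀ j → ρ (ι j) ≡ j) →
    (g : Polym (𝐀 ⊗^ k) (𝐁 ⊗^ k) L) → ∀ v → coordinatewise (diagonalAt i₀ (proj₁ g)) v ≡ proj₁ g v
  coordinatewise-diagonalAt {L = L} i₀ R full ι ρ ρ∘ι (g , g-hom) v = lookup-ext λ j → begin
    lookup (map (diagonalAt i₀ g) x) j                     ≡⟨ lookup-map j (diagonalAt i₀ g) x ⟩
    diagonalAt i₀ g (lookup x j)                           ≡⟨ cong (diagonalAt i₀ g) (c∘ι j) ⟨
    diagonalAt i₀ g (lookup c (ι j))                       ≡⟨ diagonalAt-tensorTupleᵀ {c = c} {b} g-tensor i₀ (ι j) ⟩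
    lookup b (ι j)                                         ≡⟨ trans (lookup-map j (lookup b) (tabulate ι))
                                                                    (cong (lookup b) (lookup∘tabulate ι j)) ⟨
    lookup (map (lookup b) (tabulate ι)) j                 ≡⟨ cong (λ ys → lookup ys j)
                                                                   (tensorTupleᵀ-image {c = c} {b} g-tensor (tabulate ι)) ⟨
    lookup (g (transpose (map (lookup c) (tabulate ι)))) j ≡⟨ cong (λ xss → lookup (g (transpose xss)) j) c∘ι-all ⟩
    lookup (g (transpose x)) j                             ≡⟨ cong (λ xss → lookup (g xss) j) (transpose-involutive v) ⟩
    lookup (g v) j                                         ∎
    where
    x : Vec (Vec (Carrier 𝐀) L) k
    x = transpose v
    c : Vec (Vec (Carrier 𝐀) L) (ar σ R)
    c = tabulate (lookup x ∘ ρ)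
    gc∈R : rel (𝐁 ⊗^ k) R (map g (tensorTupleᵀ k c))
    gc∈R = g-hom R (tensorTupleᵀ k c) (tensorTupleᵀ-rel 𝐀 k R c (λ ℓ → full (column ℓ c)))
    b : Vec (Carrier 𝐁) (ar σ R)
    b = proj₁ gc∈R
    g-tensor : map g (tensorTupleᵀ k c) ≡ tensorTuple k b
    g-tensor = proj₂ (proj₂ gc∈R)
    c∘ι : ∀ j → lookup c (ι j) ≡ lookup x j
    c∘ι j = trans (lookup∘tabulate (lookup x ∘ ρ) (ι j)) (cong (lookup x) (ρ∘ι j))
    c∘ι-all : map (lookup c) (tabulate ι) ≡ x
    c∘ι-all = lookup-ext λ j →
      trans (lookup-map j (lookup c) (tabulate ι)) (trans (cong (lookup c) (lookup∘tabulate ι j)) (c∘ι j))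

theorem7p3 : ∀ {σ : Sig} (k : ℕ) → NonZero k →
    (𝐀 𝐁 : Structure σ) → Finite 𝐀 → Finite 𝐁 → Hom 𝐀 𝐁 →
    HomEquivalent (Pol 𝐀 𝐁) (Pol (𝐀 ⊗^ k) (𝐁 ⊗^ k)) ×
    (Enhanced k 𝐀 → MinionIso (Pol 𝐀 𝐁) (Pol (𝐀 ⊗^ k) (𝐁 ⊗^ k)))
theorem7p3 (suc k) _ 𝐀 𝐁 _ _ _ = (coordinatewiseHom 𝐀 𝐁 (suc k) , diagonalHom 𝐀 𝐁 (suc k) fz) , iso
  where
  iso : Enhanced (suc k) 𝐀 → MinionIso (Pol 𝐀 𝐁) (Pol (𝐀 ⊗^ suc k) (𝐁 ⊗^ suc k))
  iso (R , arR≡k , full) = record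
    { to      = coordinatewiseHom 𝐀 𝐁 (suc k)
    ; from    = diagonalHom 𝐀 𝐁 (suc k) fz
    ; from∘to = λ f → diagonalAt-coordinatewise fz (proj₁ f)
    ; to∘from = coordinatewise-diagonalAt 𝐀 𝐁 (suc k) fz R full
                  (cast (sym arR≡k)) (cast arR≡k) (cast-involutive arR≡k (sym arR≡k))
    }
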